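{- Let $A:\langle k,X\rangle\rightarrow\langle l,Y\rangle$, $B:\langle l,Y\rangle\rightarrow\langle m,Z\rangle$ and $C:\langle m,Z\rangle\rightarrow\langle n,W\rangle$ be (concrete) fuzzy bigraphs whose supports $|A|$, $|B|$, $|C|$ are pairwise disjoint, so that all the composites below are defined. Then \[ C\circ(B\circ A)=(C\circ B)\circ A . \]
   Context: Throughout, $L$ is a frame: a partially ordered set in which every subset has a join $\bigvee$, every finite subset has a meet $\wedge$, and $x\wedge\bigvee Y=\bigvee\{x\wedge y\mid y\in Y\}$; $\top,\bot$ denote its top and bottom. An $L$-fuzzy relation between sets $S,T$ is a map $R:S\times T\rightarrow L$; the composite of $R:S\times T\to L$ and $Q:T\times U\to L$ is $(Q\circ R)(s,u)=\bigvee_{t\in T}R(s,t)\wedge Q(t,u)$. $S\uplus T$ denotes the union of disjoint sets; for fuzzy relations on disjoint domains, $R\uplus R'$ is the fuzzy relation agreeing with $R$ on the domain of $R$ and with $R'$ on the domain of $R'$. A natural number $m$ is identified with the set $\{0,\dots,m-1\}$. Fix an infinite set $\mathcal{V}$ of node identifiers, an infinite set $\mathcal{E}$ of edge identifiers, an infinite set $\mathcal{X}$ of names, and a set $\mathcal{K}$ of controls with an arity map $\mathrm{ar}:\mathcal{K}\to\mathbb{N}$. A fuzzy place graph $F=(V_F,\mathrm{ctrl}_F,\mathrm{prnt}_F):k\rightarrow m$ consists of a finite $V_F\subset\mathcal{V}$ and $L$-fuzzy relations $\mathrm{ctrl}_F:V_F\times\mathcal{K}\to L$ and $\mathrm{prnt}_F:(k\uplus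 V_F)\times(V_F\uplus m)\to L$. A fuzzy link graph $F=(V_F,E_F,\mathrm{ctrl}_F,\mathrm{link}_F):X\rightarrow Y$ (with $X,Y$ finite subsets of $\mathcal{X}$) consists of finite $V_F\subset\mathcal{V}$, $E_F\subset\mathcal{E}$, a fuzzy relation $\mathrm{ctrl}_F:V_F\times\mathcal{K}\to L$, a finite set $P_F$ of ports (pairs $(v,i)$ with $v\in V_F$), and an $L$-fuzzy relation $\mathrm{link}_F:(X\uplus P_F)\times(E_F\uplus Y)\to L$. A fuzzy bigraph $F=(V_F,E_F,\mathrm{ctrl}_F,\mathrm{prnt}_F,\mathrm{link}_F):\langle k,X\rangle\rightarrow\langle m,Y\rangle$ consists of a fuzzy place graph $F^{\mathsf P}=(V_F,\mathrm{ctrl}_F,\mathrm{prnt}_F):k\to m$ and a fuzzy link graph $F^{\mathsf L}=(V_F,E_F,\mathrm{ctrl}_F,\mathrm{link}_F):X\to Y$; its support is $|F|=V_F\uplus E_F$. Composition of place graphs: for $F:k\to m$, $G:m\to n$ with $V_F\cap V_G=\emptyset$, $G\circ F=(V,\mathrm{ctrl},\mathrm{prnt}):k\to n$ with $V=V_F\uplus V_G$, $\mathrm{ctrl}=\mathrm{ctrl}_F\uplus\mathrm{ctrl}_G$, and $\mathrm{prnt}(w,w')=\mathrm{prnt}_F(w,w')$ if $w\in k\uplus V_F$, $w'\in V_F$; $=\bigvee_{j\in m}\mathrm{prnt}_F(w,j)\wedge\mathrm{prnt}_G(j,w')$ if $w\in k\uplus V_F$, $w'\in V_G\uplus n$; $=\mathrm{prnt}_G(w,w')$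 if $w\in V_G$, $w'\in V_G\uplus n$; $=\bot$ otherwise. Composition of link graphs: for $F:X\to Y$, $G:Y\to Z$ with disjoint supports, $G\circ F=(V_F\uplus V_G,E_F\uplus E_G,\mathrm{ctrl}_F\uplus\mathrm{ctrl}_G,\mathrm{link}):X\to Z$ with ports $P_F\uplus P_G$ and $\mathrm{link}(q,q')=\mathrm{link}_F(q,q')$ if $q\in X\uplus P_F$, $q'\in E_F$; $=\bigvee_{y\in Y}\mathrm{link}_F(q,y)\wedge\mathrm{link}_G(y,q')$ if $q\in X\uplus P_F$, $q'\in E_G\uplus Z$; $=\mathrm{link}_G(q,q')$ if $q\in P_G$, $q'\in E_G\uplus Z$; $=\bot$ otherwise. Composition of fuzzy bigraphs $F:I\to J$, $G:J\to K$ with $|F|\cap|G|=\emptyset$ is componentwise: $G\circ F=(G^{\mathsf P}\circ F^{\mathsf P},\,G^{\mathsf L}\circ F^{\mathsf L}):I\to K$. -}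

module Defs where

open import Level using (Level; Lift; _⊔_) renaming (suc to lsuc; zero to lzero)
open import Data.Nat using (ℕ)
open import Data.Fin using (Fin)
open import Data.Bool using (Bool; true; false; T; _∨_)
open import Data.Unit using (tt)
open import Data.Empty renaming (⊥ to Empty)
open import Data.Product using (Σ; ∃; _×_; _,_; proj₁; proj₂)
open import Data.Sum using (_⊎_; inj₁; inj₂; [_,_]′)
import Data.Sum
import Relation.Binary.PropositionalEquality
open import Data.List using (List; _++_)
open import Data.List.Membership.Propositional using (_∈_)
open import Data.List.Membership.Propositional.Properties using (∈-++⁺ˡ; ∈-++⁺ʳ)
open import Relation.Binary.PropositionalEquality using (_≡_)
open import Relation.Binary.Structures using (IsPartialOrder)
open import Function.Bundles using (_↣_)

record Frame (c : Level) : Set (lsuc c) where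
  infix 4 _≤_
  infixr 7 _∧_
  field
    Carrier        : Set c
    _≤_            : Carrier → Carrier → Set c
    isPartialOrder : IsPartialOrder _≡_ _≤_
    ⋁              : (Carrier → Set c) → Carrier
    ⋁-upper        : ∀ (S : Carrier → Set c) x → S x → x ≤ ⋁ S
    ⋁-least        : ∀ (S : Carrier → Set c) y → (∀ x → S x → x ≤ y) → ⋁ S ≤ y
    _∧_            : Carrier → Carrier → Carrier
    ∧-lowerˡ       : ∀ x y → x ∧ y ≤ x
    ∧-lowerʳ       : ∀ x y → x ∧ y ≤ y
    ∧-greatest     : ∀ x y z → z ≤ x → z ≤ y → z ≤ x ∧ y
    ⊤              : Carrier
    ⊤-maximum      : ∀ x → x ≤ ⊤
    distrib        : ∀ x (S : Carrier → Set c) →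
                     x ∧ ⋁ S ≡ ⋁ (λ z → ∃ λ y → S y × (z ≡ x ∧ y))

  ⊥ : Carrier
  ⊥ = ⋁ (λ _ → Lift c Empty)

  ⋁[_] : (I : Set) → (I → Carrier) → Carrier
  ⋁[ I ] f = ⋁ (λ z → Σ I λ i → z ≡ f i)

-- The ambient data: infinite sets of node identifiers, edge identifiers,
-- names; controls with arities.

record Signature : Set₁ where
  field
    𝒱 𝓔 𝒳 𝒦 : Set
    ar        : 𝒦 → ℕ
    𝒱-infinite : ℕ ↣ 𝒱
    𝓔-infinite : ℕ ↣ 𝓔
    𝒳-infinite : ℕ ↣ 𝒳

Sub : Set → Set
Sub A = A → Bool

Elem : {A : Set} → Sub A → Set
Elem {A} S = Σ A (λ a → T (S a))

Finite : {A : Set} → Sub A → Set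
Finite {A} S = ∃ λ (xs : List A) → ∀ a → T (S a) → a ∈ xs

_∪_ : {A : Set} → Sub A → Sub A → Sub A
(S ∪ S') a = S a ∨ S' a

Disjoint : {A : Set} → Sub A → Sub A → Set
Disjoint {A} S S' = ∀ a → T (S a) → T (S' a) → Empty

splitB : (b b' : Bool) → T (b ∨ b') → T b ⊎ T b'
splitB true  _ t = inj₁ t
splitB false _ t = inj₂ t

injˡB : (b b' : Bool) → T b → T (b ∨ b')
injˡB true _ t = tt

injʳB : (b b' : Bool) → T b' → T (b ∨ b')
injʳB true  _ _ = tt
injʳB false _ t = t

splitElem : {A : Set} {S S' : Sub A} → Elem (S ∪ S') → Elem S ⊎ Elem S'
splitElem {S = S} {S'} (a , p) with splitB (S a) (S' a) p
... | inj₁ q = inj₁ (a , q)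
... | inj₂ q = inj₂ (a , q)

∪-finite : {A : Set} {S S' : Sub A} → Finite S → Finite S' → Finite (S ∪ S')
∪-finite {S = S} {S'} (xs , f) (ys , g) = xs ++ ys , h
  where
  h : ∀ a → T ((S ∪ S') a) → a ∈ xs ++ ys
  h a p with splitB (S a) (S' a) p
  ... | inj₁ q = ∈-++⁺ˡ (f a q)
  ... | inj₂ q = ∈-++⁺ʳ xs (g a q)

∪-disjointˡ : {A : Set} {S S' U : Sub A} → Disjoint S U → Disjoint S' U → Disjoint (S ∪ S') U
∪-disjointˡ {S = S} {S'} d d' a p u with splitB (S a) (S' a) p
... | inj₁ q = d a q u
... | inj₂ q = d' a q u

∪-disjointʳ : {A : Set} {S U U' : Sub A} → Disjoint S U → Disjoint S U' → Disjoint S (U ∪ U')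
∪-disjointʳ {U = U} {U'} d d' a s p with splitB (U a) (U' a) p
... | inj₁ q = d a s q
... | inj₂ q = d' a s q

record FinSub (A : Set) : Set where
  constructor finSub
  field
    set    : Sub A
    finite : Finite set
open FinSub public

module FuzzyBigraphs {c : Level} (L : Frame c) (Sg : Signature) where
  open Frame L
  open Signature Sg

  Port : Set
  Port = 𝒱 × ℕ

  Names : Set
  Names = FinSub 𝒳

  record PlaceGraph (k m : ℕ) : Set c where
    field
      V     : Sub 𝒱
      V-fin : Finite V
      ctrl  : Elem V → 𝒦 → Carrier
      prnt  : Fin k ⊎ Elem V → Elem V ⊎ Fin m → Carrier

  record LinkGraph (X Y : Names) : Set c where
    field
      V      : Sub 𝒱
      V-fin  : Finite V
      E      : Sub 𝓔
      E-fin  : Finite E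
      ctrl   : Elem V → 𝒦 → Carrier
      P      : Sub Port
      P-fin  : Finite P
      P-node : ∀ v i → T (P (v , i)) → T (V v)
      link   : Elem (set X) ⊎ Elem P → Elem E ⊎ Elem (set Y) → Carrier

  record Bigraph (k : ℕ) (X : Names) (m : ℕ) (Y : Names) : Set c where
    field
      V      : Sub 𝒱
      V-fin  : Finite V
      E      : Sub 𝓔
      E-fin  : Finite E
      ctrl   : Elem V → 𝒦 → Carrier
      prnt   : Fin k ⊎ Elem V → Elem V ⊎ Fin m → Carrier
      P      : Sub Port
      P-fin  : Finite P
      P-node : ∀ v i → T (P (v , i)) → T (V v)
      link   : Elem (set X) ⊎ Elem P → Elem E ⊎ Elem (set Y) → Carrier

    placeGraph : PlaceGraph k m
    placeGraph = record { V = V ; V-fin = V-fin ; ctrl = ctrl ; prnt = prnt }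

    linkGraph : LinkGraph X Y
    linkGraph = record { V = V ; V-fin = V-fin ; E = E ; E-fin = E-fin ; ctrl = ctrl
                       ; P = P ; P-fin = P-fin ; P-node = P-node ; link = link }

  -- support |F| = V_F ⊎ E_F ; disjointness of supports
  SupportDisjoint : ∀ {k X l Y m Z n W} → Bigraph k X l Y → Bigraph m Z n W → Set
  SupportDisjoint F G = Disjoint (Bigraph.V F) (Bigraph.V G) × Disjoint (Bigraph.E F) (Bigraph.E G)

  ctrl-∪ : {VF VG : Sub 𝒱} → (Elem VF → 𝒦 → Carrier) → (Elem VG → 𝒦 → Carrier) →
           Elem (VF ∪ VG) → 𝒦 → Carrier
  ctrl-∪ cF cG e = [ cF , cG ]′ (splitElem e)

  module _ {k m n : ℕ} where

    place-prnt : {VF VG : Sub 𝒱} →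
      (Fin k ⊎ Elem VF → Elem VF ⊎ Fin m → Carrier) →
      (Fin m ⊎ Elem VG → Elem VG ⊎ Fin n → Carrier) →
      Fin k ⊎ Elem (VF ∪ VG) → Elem (VF ∪ VG) ⊎ Fin n → Carrier
    place-prnt {VF} {VG} pF pG w w' = go (classDom w) (classCod w')
      where
      classDom : Fin k ⊎ Elem (VF ∪ VG) → (Fin k ⊎ Elem VF) ⊎ Elem VG
      classDom (inj₁ i) = inj₁ (inj₁ i)
      classDom (inj₂ e) with splitElem {S = VF} {VG} e
      ... | inj₁ f = inj₁ (inj₂ f)
      ... | inj₂ g = inj₂ g
      classCod : Elem (VF ∪ VG) ⊎ Fin n → Elem VF ⊎ (Elem VG ⊎ Fin n)
      classCod (inj₂ j) = inj₂ (inj₂ j)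
      classCod (inj₁ e) with splitElem {S = VF} {VG} e
      ... | inj₁ f = inj₁ f
      ... | inj₂ g = inj₂ (inj₁ g)
      go : (Fin k ⊎ Elem VF) ⊎ Elem VG → Elem VF ⊎ (Elem VG ⊎ Fin n) → Carrier
      go (inj₁ a) (inj₁ b) = pF a (inj₁ b)
      go (inj₁ a) (inj₂ b) = ⋁[ Fin m ] (λ j → pF a (inj₂ j) ∧ pG (inj₁ j) b)
      go (inj₂ g) (inj₂ b) = pG (inj₂ g) b
      go (inj₂ g) (inj₁ b) = ⊥

    _∘P_[_] : (G : PlaceGraph m n) → (F : PlaceGraph k m) →
              Disjoint (PlaceGraph.V F) (PlaceGraph.V G) → PlaceGraph k n
    (G ∘P F [ _ ]) = record
      { V     = PlaceGraph.V F ∪ PlaceGraph.V G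
      ; V-fin = ∪-finite (PlaceGraph.V-fin F) (PlaceGraph.V-fin G)
      ; ctrl  = ctrl-∪ (PlaceGraph.ctrl F) (PlaceGraph.ctrl G)
      ; prnt  = place-prnt (PlaceGraph.prnt F) (PlaceGraph.prnt G)
      }

  module _ {X Y Z : Names} where

    link-link : {PF PG : Sub Port} {EF EG : Sub 𝓔} →
      (Elem (set X) ⊎ Elem PF → Elem EF ⊎ Elem (set Y) → Carrier) →
      (Elem (set Y) ⊎ Elem PG → Elem EG ⊎ Elem (set Z) → Carrier) →
      Elem (set X) ⊎ Elem (PF ∪ PG) → Elem (EF ∪ EG) ⊎ Elem (set Z) → Carrier
    link-link {PF} {PG} {EF} {EG} lF lG q q' = go (classDom q) (classCod q')
      where
      classDom : Elem (set X) ⊎ Elem (PF ∪ PG) → (Elem (set X) ⊎ Elem PF) ⊎ Elem PG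
      classDom (inj₁ x) = inj₁ (inj₁ x)
      classDom (inj₂ e) with splitElem {S = PF} {PG} e
      ... | inj₁ f = inj₁ (inj₂ f)
      ... | inj₂ g = inj₂ g
      classCod : Elem (EF ∪ EG) ⊎ Elem (set Z) → Elem EF ⊎ (Elem EG ⊎ Elem (set Z))
      classCod (inj₂ z) = inj₂ (inj₂ z)
      classCod (inj₁ e) with splitElem {S = EF} {EG} e
      ... | inj₁ f = inj₁ f
      ... | inj₂ g = inj₂ (inj₁ g)
      go : (Elem (set X) ⊎ Elem PF) ⊎ Elem PG → Elem EF ⊎ (Elem EG ⊎ Elem (set Z)) → Carrier
      go (inj₁ a) (inj₁ b) = lF a (inj₁ b)
      go (inj₁ a) (inj₂ b) = ⋁[ Elem (set Y) ] (λ y → lF a (inj₂ y) ∧ lG (inj₁ y) b)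
      go (inj₂ g) (inj₂ b) = lG (inj₂ g) b
      go (inj₂ g) (inj₁ b) = ⊥

    P-node-∪ : {PF PG : Sub Port} {VF VG : Sub 𝒱} →
      (∀ v i → T (PF (v , i)) → T (VF v)) → (∀ v i → T (PG (v , i)) → T (VG v)) →
      ∀ v i → T ((PF ∪ PG) (v , i)) → T ((VF ∪ VG) v)
    P-node-∪ {PF} {PG} {VF} {VG} hF hG v i p with splitB (PF (v , i)) (PG (v , i)) p
    ... | inj₁ q = injˡB (VF v) (VG v) (hF v i q)
    ... | inj₂ q = injʳB (VF v) (VG v) (hG v i q)

    _∘L_[_] : (G : LinkGraph Y Z) → (F : LinkGraph X Y) →
              Disjoint (LinkGraph.V F) (LinkGraph.V G) × Disjoint (LinkGraph.E F) (LinkGraph.E G) →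
              LinkGraph X Z
    (G ∘L F [ _ ]) = record
      { V      = LinkGraph.V F ∪ LinkGraph.V G
      ; V-fin  = ∪-finite (LinkGraph.V-fin F) (LinkGraph.V-fin G)
      ; E      = LinkGraph.E F ∪ LinkGraph.E G
      ; E-fin  = ∪-finite (LinkGraph.E-fin F) (LinkGraph.E-fin G)
      ; ctrl   = ctrl-∪ (LinkGraph.ctrl F) (LinkGraph.ctrl G)
      ; P      = LinkGraph.P F ∪ LinkGraph.P G
      ; P-fin  = ∪-finite (LinkGraph.P-fin F) (LinkGraph.P-fin G)
      ; P-node = P-node-∪ (LinkGraph.P-node F) (LinkGraph.P-node G)
      ; link   = link-link (LinkGraph.link F) (LinkGraph.link G)
      }

  _∘_[_] : ∀ {k X l Y m Z} (G : Bigraph l Y m Z) (F : Bigraph k X l Y) →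
           SupportDisjoint F G → Bigraph k X m Z
  G ∘ F [ d ] = record
    { V      = PlaceGraph.V p
    ; V-fin  = PlaceGraph.V-fin p
    ; E      = LinkGraph.E ln
    ; E-fin  = LinkGraph.E-fin ln
    ; ctrl   = PlaceGraph.ctrl p
    ; prnt   = PlaceGraph.prnt p
    ; P      = LinkGraph.P ln
    ; P-fin  = LinkGraph.P-fin ln
    ; P-node = LinkGraph.P-node ln
    ; link   = LinkGraph.link ln
    }
    where
    p  = Bigraph.placeGraph G ∘P Bigraph.placeGraph F [ proj₁ d ]
    ln = Bigraph.linkGraph G ∘L Bigraph.linkGraph F [ d ]

  -- supports of a composite: |G ∘ F| = |F| ⊎ |G|, hence disjointness propagates
  ∘-disjointˡ : ∀ {k X l Y m Z n W} {A : Bigraph k X l Y} {B : Bigraph l Y m Z} {C : Bigraph m Z n W}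
    (dAB : SupportDisjoint A B) → SupportDisjoint A C → SupportDisjoint B C →
    SupportDisjoint (B ∘ A [ dAB ]) C
  ∘-disjointˡ _ (dV , dE) (dV' , dE') = ∪-disjointˡ dV dV' , ∪-disjointˡ dE dE'

  ∘-disjointʳ : ∀ {k X l Y m Z n W} {A : Bigraph k X l Y} {B : Bigraph l Y m Z} {C : Bigraph m Z n W}
    (dBC : SupportDisjoint B C) → SupportDisjoint A B → SupportDisjoint A C →
    SupportDisjoint A (C ∘ B [ dBC ])
  ∘-disjointʳ _ (dV , dE) (dV' , dE') = ∪-disjointʳ dV dV' , ∪-disjointʳ dE dE'

  -- equality of concrete fuzzy bigraphs: same node/edge/port sets, and
  -- ctrl, prnt, link agree at every pair of (underlying) arguments.

  rawPlaceDom : ∀ {k} {V : Sub 𝒱} → Fin k ⊎ Elem V → Fin k ⊎ 𝒱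
  rawPlaceDom = Data.Sum.map (λ i → i) proj₁

  rawPlaceCod : ∀ {m} {V : Sub 𝒱} → Elem V ⊎ Fin m → 𝒱 ⊎ Fin m
  rawPlaceCod = Data.Sum.map proj₁ (λ j → j)

  rawLinkDom : ∀ {X : Names} {P : Sub Port} → Elem (set X) ⊎ Elem P → 𝒳 ⊎ Port
  rawLinkDom = Data.Sum.map proj₁ proj₁

  rawLinkCod : ∀ {Y : Names} {E : Sub 𝓔} → Elem E ⊎ Elem (set Y) → 𝓔 ⊎ 𝒳
  rawLinkCod = Data.Sum.map proj₁ proj₁

  record _≈_ {k X m Y} (F G : Bigraph k X m Y) : Set c where
    module F = Bigraph F
    module G = Bigraph G
    field
      V-eq    : ∀ v → F.V v ≡ G.V v
      E-eq    : ∀ e → F.E e ≡ G.E e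
      P-eq    : ∀ p → F.P p ≡ G.P p
      ctrl-eq : ∀ v (p : T (F.V v)) (q : T (G.V v)) κ → F.ctrl (v , p) κ ≡ G.ctrl (v , q) κ
      prnt-eq : ∀ a a' b b' → rawPlaceDom {k} {F.V} a ≡ rawPlaceDom {k} {G.V} a' →
                rawPlaceCod {m} {F.V} b ≡ rawPlaceCod {m} {G.V} b' →
                F.prnt a b ≡ G.prnt a' b'
      link-eq : ∀ a a' b b' → rawLinkDom {X} {F.P} a ≡ rawLinkDom {X} {G.P} a' →
                rawLinkCod {Y} {F.E} b ≡ rawLinkCod {Y} {G.E} b' →
                F.link a b ≡ G.link a' b'

module Submission where

open import Defs
open import Data.Nat using (ℕ)
open import Data.Fin using (Fin)
open import Data.Bool using (true; false; T; _∨_)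
open import Data.Bool.Properties using (∨-assoc; T-irrelevant)
open import Data.Product using (_×_; _,_; proj₁; proj₂)
open import Data.Sum using (_⊎_; inj₁; inj₂; [_,_]′; map₁; map₂)
import Data.Sum as Sum
open import Data.Sum.Properties using (inj₁-injective; inj₂-injective)
open import Data.Empty using (⊥-elim)
open import Function.Definitions using (Injective)
open import Relation.Nullary using (¬_)
open import Relation.Binary.Structures using (IsPartialOrder)
open import Relation.Binary.PropositionalEquality using (_≡_; refl; sym; trans; cong; cong₂; cong-app; subst₂; module ≡-Reasoning)

-- Both the parent map and the link map of a composite G ∘ F come from one operation F ⨾ G on
-- fuzzy relations I ⊎ D → C ⊎ J whose inner sorts D, C are split into an F-part and a G-part:
-- in block form it is F on the F×F block, the sup-inf composite through the shared interface
-- on the F×G block, G on the G×G block and ⊥ on the G×F block. By disjointness of the supports,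
-- each inner point of a threefold composite lies in exactly one of the parts of A, B, C, and the
-- two bracketings agree block by block. The only blocks that are not equal on the nose are those
-- from A (or the outer domain) to C (or the outer codomain), where associativity of sup-inf
-- composition is exactly the frame distributive law.

splitB-injˡB : ∀ b b' (t : T b) → splitB b b' (injˡB b b' t) ≡ inj₁ t
splitB-injˡB true _ _ = refl

splitB-injʳB : ∀ b b' (t : T b') → ¬ T b → splitB b b' (injʳB b b' t) ≡ inj₂ t
splitB-injʳB true  _ _ ¬t = ⊥-elim (¬t _)
splitB-injʳB false _ _ _  = refl

module _ {A : Set} where

  Elem-proj₁-injective : {S : Sub A} → Injective _≡_ _≡_ (proj₁ {B = λ a → T (S a)})
  Elem-proj₁-injective {x = a , s} {.a , s'} refl = cong (a ,_) (T-irrelevant s s')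

  module _ {S S' : Sub A} where

    inˡ : Elem S → Elem (S ∪ S')
    inˡ (a , s) = a , injˡB (S a) (S' a) s

    inʳ : Elem S' → Elem (S ∪ S')
    inʳ (a , s) = a , injʳB (S a) (S' a) s

    splitElem-inˡ : (x : Elem S) → splitElem {S = S} {S'} (inˡ x) ≡ inj₁ x
    splitElem-inˡ (a , s) rewrite splitB-injˡB (S a) (S' a) s = refl

    splitElem-inʳ : Disjoint S S' → (x : Elem S') → splitElem {S = S} {S'} (inʳ x) ≡ inj₂ x
    splitElem-inʳ d (a , s) rewrite splitB-injʳB (S a) (S' a) s (λ t → d a t s) = refl

    domˡ : {I : Set} → I ⊎ Elem S → I ⊎ Elem (S ∪ S')
    domˡ = map₂ inˡ

    codʳ : {J : Set} → Elem S' ⊎ J → Elem (S ∪ S') ⊎ J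
    codʳ = map₁ inʳ

  Disjoint₃ : Sub A → Sub A → Sub A → Set
  Disjoint₃ SA SB SC = Disjoint SA SB × Disjoint SA SC × Disjoint SB SC

  module _ {SA SB SC : Sub A} where

    data Parts₃ : Elem ((SA ∪ SB) ∪ SC) → Elem (SA ∪ (SB ∪ SC)) → Set where
      inA : (x : Elem SA) → Parts₃ (inˡ (inˡ x)) (inˡ x)
      inB : (x : Elem SB) → Parts₃ (inˡ {S' = SC} (inʳ {S = SA} x)) (inʳ {S = SA} (inˡ {S' = SC} x))
      inC : (x : Elem SC) → Parts₃ (inʳ x) (inʳ {S = SA} (inʳ {S = SB} x))

    parts₃ : {e : Elem ((SA ∪ SB) ∪ SC)} {e' : Elem (SA ∪ (SB ∪ SC))} →
             proj₁ e ≡ proj₁ e' → Parts₃ e e'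
    parts₃ {a , p} {.a , p'} refl with splitB (SA a ∨ SB a) (SC a) p
    ... | inj₂ s = subst₂ Parts₃ (Elem-proj₁-injective refl) (Elem-proj₁-injective refl) (inC (a , s))
    ... | inj₁ ab with splitB (SA a) (SB a) ab
    ...   | inj₁ s = subst₂ Parts₃ (Elem-proj₁-injective refl) (Elem-proj₁-injective refl) (inA (a , s))
    ...   | inj₂ s = subst₂ Parts₃ (Elem-proj₁-injective refl) (Elem-proj₁-injective refl) (inB (a , s))

    -- A point of the outer interface behaves like a point of A, so the two are grouped together.
    data DomParts {I : Set} : I ⊎ Elem ((SA ∪ SB) ∪ SC) → I ⊎ Elem (SA ∪ (SB ∪ SC)) → Set where
      viaA : (a : I ⊎ Elem SA) → DomParts (domˡ (domˡ a)) (domˡ a)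
      viaB : (x : Elem SB) → DomParts (inj₂ (inˡ {S' = SC} (inʳ {S = SA} x))) (inj₂ (inʳ {S = SA} (inˡ {S' = SC} x)))
      viaC : (x : Elem SC) → DomParts (inj₂ (inʳ x)) (inj₂ (inʳ {S = SA} (inʳ {S = SB} x)))

    data CodParts {J : Set} : Elem ((SA ∪ SB) ∪ SC) ⊎ J → Elem (SA ∪ (SB ∪ SC)) ⊎ J → Set where
      viaA : (y : Elem SA) → CodParts (inj₁ (inˡ (inˡ y))) (inj₁ (inˡ y))
      viaB : (y : Elem SB) → CodParts (inj₁ (inˡ {S' = SC} (inʳ {S = SA} y))) (inj₁ (inʳ {S = SA} (inˡ {S' = SC} y)))
      viaC : (b : Elem SC ⊎ J) → CodParts (codʳ b) (codʳ {S = SA} (codʳ {S = SB} b))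

    domParts : {I I' : Set} {f : I → I'} → Injective _≡_ _≡_ f →
               {a : I ⊎ Elem ((SA ∪ SB) ∪ SC)} {a' : I ⊎ Elem (SA ∪ (SB ∪ SC))} →
               Sum.map f proj₁ a ≡ Sum.map f proj₁ a' → DomParts a a'
    domParts f-inj {inj₁ i} {inj₁ i'} eq with f-inj (inj₁-injective eq)
    ... | refl = viaA (inj₁ i)
    domParts f-inj {inj₂ e} {inj₂ e'} eq with parts₃ {e} {e'} (inj₂-injective eq)
    ... | inA x = viaA (inj₂ x)
    ... | inB x = viaB x
    ... | inC x = viaC x

    codParts : {J J' : Set} {g : J → J'} → Injective _≡_ _≡_ g →
               {b : Elem ((SA ∪ SB) ∪ SC) ⊎ J} {b' : Elem (SA ∪ (SB ∪ SC)) ⊎ J} →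
               Sum.map proj₁ g b ≡ Sum.map proj₁ g b' → CodParts b b'
    codParts g-inj {inj₂ j} {inj₂ j'} eq with g-inj (inj₂-injective eq)
    ... | refl = viaC (inj₂ j)
    codParts g-inj {inj₁ e} {inj₁ e'} eq with parts₃ {e} {e'} (inj₁-injective eq)
    ... | inA x = viaA x
    ... | inB x = viaB x
    ... | inC x = viaC (inj₁ x)

module FrameProperties {c} (L : Frame c) where
  open Frame L
  open IsPartialOrder isPartialOrder using (antisym; reflexive) renaming (refl to ≤-refl; trans to ≤-trans)
  open ≡-Reasoning

  ∧-mono : ∀ {x x' y y'} → x ≤ x' → y ≤ y' → x ∧ y ≤ x' ∧ y'
  ∧-mono p q = ∧-greatest _ _ _ (≤-trans (∧-lowerˡ _ _) p) (≤-trans (∧-lowerʳ _ _) q)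

  ∧-comm : ∀ x y → x ∧ y ≡ y ∧ x
  ∧-comm x y = antisym (swap x y) (swap y x)
    where
    swap : ∀ x y → x ∧ y ≤ y ∧ x
    swap x y = ∧-greatest _ _ _ (∧-lowerʳ x y) (∧-lowerˡ x y)

  ∧-assoc : ∀ x y z → (x ∧ y) ∧ z ≡ x ∧ (y ∧ z)
  ∧-assoc x y z = antisym
    (∧-greatest _ _ _ (≤-trans (∧-lowerˡ _ _) (∧-lowerˡ _ _)) (∧-mono (∧-lowerʳ _ _) ≤-refl))
    (∧-greatest _ _ _ (∧-mono ≤-refl (∧-lowerˡ _ _)) (≤-trans (∧-lowerʳ _ _) (∧-lowerʳ _ _)))

  module _ {I : Set} where

    ⋁[]-upper : ∀ (f : I → Carrier) i → f i ≤ ⋁[ I ] f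
    ⋁[]-upper f i = ⋁-upper _ (f i) (i , refl)

    ⋁[]-least : ∀ (f : I → Carrier) {y} → (∀ i → f i ≤ y) → ⋁[ I ] f ≤ y
    ⋁[]-least f {y} h = ⋁-least _ y λ { _ (i , refl) → h i }

    ⋁[]-mono : ∀ {f g : I → Carrier} → (∀ i → f i ≤ g i) → ⋁[ I ] f ≤ ⋁[ I ] g
    ⋁[]-mono {f} {g} h = ⋁[]-least f λ i → ≤-trans (h i) (⋁[]-upper g i)

    ⋁[]-cong : ∀ {f g : I → Carrier} → (∀ i → f i ≡ g i) → ⋁[ I ] f ≡ ⋁[ I ] g
    ⋁[]-cong h = antisym (⋁[]-mono λ i → reflexive (h i)) (⋁[]-mono λ i → reflexive (sym (h i)))

    ∧-distribˡ-⋁[] : ∀ x (f : I → Carrier) → x ∧ ⋁[ I ] f ≡ ⋁[ I ] (λ i → x ∧ f i)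
    ∧-distribˡ-⋁[] x f = antisym
      (≤-trans (reflexive (distrib x _))
               (⋁-least _ _ λ { _ (_ , (i , refl) , refl) → ⋁[]-upper (λ i → x ∧ f i) i }))
      (⋁[]-least _ λ i → ∧-mono ≤-refl (⋁[]-upper f i))

    ∧-distribʳ-⋁[] : ∀ (f : I → Carrier) x → ⋁[ I ] f ∧ x ≡ ⋁[ I ] (λ i → f i ∧ x)
    ∧-distribʳ-⋁[] f x = begin
      ⋁[ I ] f ∧ x               ≡⟨ ∧-comm _ x ⟩
      x ∧ ⋁[ I ] f               ≡⟨ ∧-distribˡ-⋁[] x f ⟩
      ⋁[ I ] (λ i → x ∧ f i)     ≡⟨ ⋁[]-cong (λ i → ∧-comm x (f i)) ⟩
      ⋁[ I ] (λ i → f i ∧ x)     ∎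

  ⋁[]-comm : ∀ {I J : Set} (f : I → J → Carrier) →
             ⋁[ J ] (λ j → ⋁[ I ] (λ i → f i j)) ≡ ⋁[ I ] (λ i → ⋁[ J ] (f i))
  ⋁[]-comm {I} {J} f = antisym
    (⋁[]-least _ λ j → ⋁[]-least _ λ i → ≤-trans (⋁[]-upper (f i) j) (⋁[]-upper _ i))
    (⋁[]-least _ λ i → ⋁[]-least _ λ j → ≤-trans (⋁[]-upper (λ i → f i j) i) (⋁[]-upper _ j))

  ⋁[]-∧-assoc : ∀ {I J : Set} (f : I → Carrier) (g : I → J → Carrier) (h : J → Carrier) →
    ⋁[ J ] (λ j → ⋁[ I ] (λ i → f i ∧ g i j) ∧ h j) ≡ ⋁[ I ] (λ i → f i ∧ ⋁[ J ] (λ j → g i j ∧ h j))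
  ⋁[]-∧-assoc {I} {J} f g h = begin
    ⋁[ J ] (λ j → ⋁[ I ] (λ i → f i ∧ g i j) ∧ h j)    ≡⟨ ⋁[]-cong (λ j → ∧-distribʳ-⋁[] _ (h j)) ⟩
    ⋁[ J ] (λ j → ⋁[ I ] (λ i → (f i ∧ g i j) ∧ h j))  ≡⟨ ⋁[]-cong (λ j → ⋁[]-cong λ i → ∧-assoc _ _ _) ⟩
    ⋁[ J ] (λ j → ⋁[ I ] (λ i → f i ∧ (g i j ∧ h j)))  ≡⟨ ⋁[]-comm _ ⟩
    ⋁[ I ] (λ i → ⋁[ J ] (λ j → f i ∧ (g i j ∧ h j)))  ≡⟨ ⋁[]-cong (λ i → sym (∧-distribˡ-⋁[] (f i) _)) ⟩
    ⋁[ I ] (λ i → f i ∧ ⋁[ J ] (λ j → g i j ∧ h j))    ∎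

module Composition {c} (L : Frame c) where
  open Frame L
  open FrameProperties L
  open ≡-Reasoning

  FuzzyRel : {𝒟 𝒞 : Set} → Set → Sub 𝒟 → Sub 𝒞 → Set → Set c
  FuzzyRel I D C J = I ⊎ Elem D → Elem C ⊎ J → Carrier

  _≗₂_ : {X Y : Set} → (X → Y → Carrier) → (X → Y → Carrier) → Set c
  R ≗₂ R' = ∀ x y → R x y ≡ R' x y

  ≗₂-refl : {X Y : Set} {R : X → Y → Carrier} → R ≗₂ R
  ≗₂-refl _ _ = refl

  module _ {𝒟 𝒞 I M J : Set} {DF DG : Sub 𝒟} {CF CG : Sub 𝒞} where

    classifyDom : I ⊎ Elem (DF ∪ DG) → (I ⊎ Elem DF) ⊎ Elem DG
    classifyDom (inj₁ i) = inj₁ (inj₁ i)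
    classifyDom (inj₂ e) = map₁ inj₂ (splitElem e)

    classifyCod : Elem (CF ∪ CG) ⊎ J → Elem CF ⊎ (Elem CG ⊎ J)
    classifyCod (inj₁ e) = map₂ inj₁ (splitElem e)
    classifyCod (inj₂ j) = inj₂ (inj₂ j)

    blocks : FuzzyRel I DF CF M → FuzzyRel M DG CG J →
             (I ⊎ Elem DF) ⊎ Elem DG → Elem CF ⊎ (Elem CG ⊎ J) → Carrier
    blocks F G (inj₁ a) (inj₁ b) = F a (inj₁ b)
    blocks F G (inj₁ a) (inj₂ b) = ⋁[ M ] λ m → F a (inj₂ m) ∧ G (inj₁ m) b
    blocks F G (inj₂ a) (inj₁ b) = ⊥
    blocks F G (inj₂ a) (inj₂ b) = G (inj₂ a) b

    _⨾_ : FuzzyRel I DF CF M → FuzzyRel M DG CG J → FuzzyRel I (DF ∪ DG) (CF ∪ CG) J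
    (F ⨾ G) a b = blocks F G (classifyDom a) (classifyCod b)

    ⨾-cong : ∀ {F F' G G'} → F ≗₂ F' → G ≗₂ G' → (F ⨾ G) ≗₂ (F' ⨾ G')
    ⨾-cong {F} {F'} {G} {G'} F≗ G≗ a b = blocks-cong (classifyDom a) (classifyCod b)
      where
      blocks-cong : blocks F G ≗₂ blocks F' G'
      blocks-cong (inj₁ a) (inj₁ b) = F≗ a (inj₁ b)
      blocks-cong (inj₁ a) (inj₂ b) = ⋁[]-cong λ m → cong₂ _∧_ (F≗ a (inj₂ m)) (G≗ (inj₁ m) b)
      blocks-cong (inj₂ a) (inj₁ b) = refl
      blocks-cong (inj₂ a) (inj₂ b) = G≗ (inj₂ a) b

    module ⨾-Blocks (F : FuzzyRel I DF CF M) (G : FuzzyRel M DG CG J)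
                    (dD : Disjoint DF DG) (dC : Disjoint CF CG) where

      private
        classifyDom-domˡ : ∀ a → classifyDom (domˡ a) ≡ inj₁ a
        classifyDom-domˡ (inj₁ i) = refl
        classifyDom-domˡ (inj₂ x) = cong (map₁ inj₂) (splitElem-inˡ x)

        classifyDom-inʳ : ∀ x → classifyDom (inj₂ (inʳ x)) ≡ inj₂ x
        classifyDom-inʳ x = cong (map₁ inj₂) (splitElem-inʳ dD x)

        classifyCod-inˡ : ∀ y → classifyCod (inj₁ (inˡ y)) ≡ inj₁ y
        classifyCod-inˡ y = cong (map₂ inj₁) (splitElem-inˡ y)

        classifyCod-codʳ : ∀ b → classifyCod (codʳ b) ≡ inj₂ b
        classifyCod-codʳ (inj₁ y) = cong (map₂ inj₁) (splitElem-inʳ dC y)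
        classifyCod-codʳ (inj₂ j) = refl

      FF : ∀ a y → (F ⨾ G) (domˡ a) (inj₁ (inˡ y)) ≡ F a (inj₁ y)
      FF a y = cong₂ (blocks F G) (classifyDom-domˡ a) (classifyCod-inˡ y)

      FG : ∀ a b → (F ⨾ G) (domˡ a) (codʳ b) ≡ ⋁[ M ] λ m → F a (inj₂ m) ∧ G (inj₁ m) b
      FG a b = cong₂ (blocks F G) (classifyDom-domˡ a) (classifyCod-codʳ b)

      GF : ∀ x y → (F ⨾ G) (inj₂ (inʳ x)) (inj₁ (inˡ y)) ≡ ⊥
      GF x y = cong₂ (blocks F G) (classifyDom-inʳ x) (classifyCod-inˡ y)

      GG : ∀ x b → (F ⨾ G) (inj₂ (inʳ x)) (codʳ b) ≡ G (inj₂ x) b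
      GG x b = cong₂ (blocks F G) (classifyDom-inʳ x) (classifyCod-codʳ b)

  module _ {𝒟 𝒞 I₀ I₁ I₂ I₃ : Set} {DA DB DC : Sub 𝒟} {CA CB CC : Sub 𝒞}
           (A : FuzzyRel I₀ DA CA I₁) (B : FuzzyRel I₁ DB CB I₂) (C : FuzzyRel I₂ DC CC I₃)
           (dD : Disjoint₃ DA DB DC) (dC : Disjoint₃ CA CB CC) where

    private
      module AB   = ⨾-Blocks A B (proj₁ dD) (proj₁ dC)
      module BC   = ⨾-Blocks B C (proj₂ (proj₂ dD)) (proj₂ (proj₂ dC))
      module AB∣C = ⨾-Blocks (A ⨾ B) C (∪-disjointˡ (proj₁ (proj₂ dD)) (proj₂ (proj₂ dD)))
                                       (∪-disjointˡ (proj₁ (proj₂ dC)) (proj₂ (proj₂ dC)))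
      module A∣BC = ⨾-Blocks A (B ⨾ C) (∪-disjointʳ (proj₁ dD) (proj₁ (proj₂ dD)))
                                       (∪-disjointʳ (proj₁ dC) (proj₁ (proj₂ dC)))

    ⨾-assoc : ∀ {a a' b b'} → DomParts {SA = DA} {DB} {DC} a a' → CodParts {SA = CA} {CB} {CC} b b' →
              ((A ⨾ B) ⨾ C) a b ≡ (A ⨾ (B ⨾ C)) a' b'
    ⨾-assoc (viaA a) (viaA y) = trans (AB∣C.FF (domˡ a) (inˡ y)) (trans (AB.FF a y) (sym (A∣BC.FF a y)))
    ⨾-assoc (viaA a) (viaB y) =
      trans (AB∣C.FF (domˡ a) (inʳ y)) (trans (AB.FG a (inj₁ y))
        (trans (⋁[]-cong λ l → cong (A a (inj₂ l) ∧_) (sym (BC.FF (inj₁ l) y))) (sym (A∣BC.FG a (inj₁ (inˡ y))))))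
    ⨾-assoc (viaA a) (viaC b) = begin
      ((A ⨾ B) ⨾ C) (domˡ (domˡ a)) (codʳ b)
        ≡⟨ AB∣C.FG (domˡ a) b ⟩
      ⋁[ I₂ ] (λ m → (A ⨾ B) (domˡ a) (inj₂ m) ∧ C (inj₁ m) b)
        ≡⟨ ⋁[]-cong (λ m → cong (_∧ C (inj₁ m) b) (AB.FG a (inj₂ m))) ⟩
      ⋁[ I₂ ] (λ m → ⋁[ I₁ ] (λ l → A a (inj₂ l) ∧ B (inj₁ l) (inj₂ m)) ∧ C (inj₁ m) b)
        ≡⟨ ⋁[]-∧-assoc _ _ _ ⟩
      ⋁[ I₁ ] (λ l → A a (inj₂ l) ∧ ⋁[ I₂ ] (λ m → B (inj₁ l) (inj₂ m) ∧ C (inj₁ m) b))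
        ≡⟨ ⋁[]-cong (λ l → cong (A a (inj₂ l) ∧_) (sym (BC.FG (inj₁ l) b))) ⟩
      ⋁[ I₁ ] (λ l → A a (inj₂ l) ∧ (B ⨾ C) (inj₁ l) (codʳ b))
        ≡⟨ sym (A∣BC.FG a (codʳ b)) ⟩
      (A ⨾ (B ⨾ C)) (domˡ a) (codʳ {S = CA} (codʳ {S = CB} b))
        ∎
    ⨾-assoc (viaB x) (viaA y) = trans (AB∣C.FF (inj₂ (inʳ x)) (inˡ y)) (trans (AB.GF x y) (sym (A∣BC.GF (inˡ x) y)))
    ⨾-assoc (viaB x) (viaB y) =
      trans (AB∣C.FF (inj₂ (inʳ x)) (inʳ y)) (trans (AB.GG x (inj₁ y))
        (sym (trans (A∣BC.GG (inˡ x) (inj₁ (inˡ y))) (BC.FF (inj₂ x) y))))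
    ⨾-assoc (viaB x) (viaC b) =
      trans (AB∣C.FG (inj₂ (inʳ x)) b) (trans (⋁[]-cong λ m → cong (_∧ C (inj₁ m) b) (AB.GG x (inj₂ m)))
        (sym (trans (A∣BC.GG (inˡ x) (codʳ b)) (BC.FG (inj₂ x) b))))
    ⨾-assoc (viaC x) (viaA y) = trans (AB∣C.GF x (inˡ y)) (sym (A∣BC.GF (inʳ x) y))
    ⨾-assoc (viaC x) (viaB y) = trans (AB∣C.GF x (inʳ y)) (sym (trans (A∣BC.GG (inʳ x) (inj₁ (inˡ y))) (BC.GF x y)))
    ⨾-assoc (viaC x) (viaC b) = trans (AB∣C.GG x b) (sym (trans (A∣BC.GG (inʳ x) (codʳ b)) (BC.GG x b)))

module _ {c} (L : Frame c) (Sg : Signature) where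
  open Frame L
  open Signature Sg
  open FuzzyBigraphs L Sg
  open FrameProperties L
  open Composition L
  open ≡-Reasoning

  place-prnt≗⨾ : ∀ {k m n} {VF VG : Sub 𝒱}
    (F : FuzzyRel (Fin k) VF VF (Fin m)) (G : FuzzyRel (Fin m) VG VG (Fin n)) →
    place-prnt F G ≗₂ (F ⨾ G)
  place-prnt≗⨾ F G (inj₁ i) (inj₂ j) = refl
  place-prnt≗⨾ {VF = VF} {VG} F G (inj₁ i) (inj₁ (w , q)) with splitB (VF w) (VG w) q
  ... | inj₁ _ = refl
  ... | inj₂ _ = refl
  place-prnt≗⨾ {VF = VF} {VG} F G (inj₂ (v , p)) (inj₂ j) with splitB (VF v) (VG v) p
  ... | inj₁ _ = refl
  ... | inj₂ _ = refl
  place-prnt≗⨾ {VF = VF} {VG} F G (inj₂ (v , p)) (inj₁ (w , q))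
    with splitB (VF v) (VG v) p | splitB (VF w) (VG w) q
  ... | inj₁ _ | inj₁ _ = refl
  ... | inj₁ _ | inj₂ _ = refl
  ... | inj₂ _ | inj₁ _ = refl
  ... | inj₂ _ | inj₂ _ = refl

  link-link≗⨾ : ∀ {X Y Z : Names} {PF PG : Sub Port} {EF EG : Sub 𝓔}
    (F : FuzzyRel (Elem (set X)) PF EF (Elem (set Y))) (G : FuzzyRel (Elem (set Y)) PG EG (Elem (set Z))) →
    link-link {X} {Y} {Z} F G ≗₂ (F ⨾ G)
  link-link≗⨾ F G (inj₁ x) (inj₂ z) = refl
  link-link≗⨾ {EF = EF} {EG} F G (inj₁ x) (inj₁ (e , q)) with splitB (EF e) (EG e) q
  ... | inj₁ _ = refl
  ... | inj₂ _ = refl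
  link-link≗⨾ {PF = PF} {PG} F G (inj₂ (π , p)) (inj₂ z) with splitB (PF π) (PG π) p
  ... | inj₁ _ = refl
  ... | inj₂ _ = refl
  link-link≗⨾ {PF = PF} {PG} {EF} {EG} F G (inj₂ (π , p)) (inj₁ (e , q))
    with splitB (PF π) (PG π) p | splitB (EF e) (EG e) q
  ... | inj₁ _ | inj₁ _ = refl
  ... | inj₁ _ | inj₂ _ = refl
  ... | inj₂ _ | inj₁ _ = refl
  ... | inj₂ _ | inj₂ _ = refl

  module _ {VF VG : Sub 𝒱} (cF : Elem VF → 𝒦 → Carrier) (cG : Elem VG → 𝒦 → Carrier) where

    ctrl-∪-inˡ : ∀ x → ctrl-∪ cF cG (inˡ x) ≡ cF x
    ctrl-∪-inˡ x = cong [ cF , cG ]′ (splitElem-inˡ x)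

    ctrl-∪-inʳ : Disjoint VF VG → ∀ x → ctrl-∪ cF cG (inʳ x) ≡ cG x
    ctrl-∪-inʳ d x = cong [ cF , cG ]′ (splitElem-inʳ d x)

  ctrl-∪-assoc : ∀ {VA VB VC : Sub 𝒱} {e e'} (cA : Elem VA → 𝒦 → Carrier) (cB : Elem VB → 𝒦 → Carrier)
    (cC : Elem VC → 𝒦 → Carrier) → Disjoint₃ VA VB VC → Parts₃ {SA = VA} {VB} {VC} e e' →
    ctrl-∪ (ctrl-∪ cA cB) cC e ≡ ctrl-∪ cA (ctrl-∪ cB cC) e'
  ctrl-∪-assoc cA cB cC _ (inA x) =
    trans (ctrl-∪-inˡ (ctrl-∪ cA cB) cC (inˡ x)) (trans (ctrl-∪-inˡ cA cB x) (sym (ctrl-∪-inˡ cA (ctrl-∪ cB cC) x)))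
  ctrl-∪-assoc cA cB cC (dAB , dAC , dBC) (inB x) =
    trans (ctrl-∪-inˡ (ctrl-∪ cA cB) cC (inʳ x)) (trans (ctrl-∪-inʳ cA cB dAB x)
      (sym (trans (ctrl-∪-inʳ cA (ctrl-∪ cB cC) (∪-disjointʳ dAB dAC) (inˡ x)) (ctrl-∪-inˡ cB cC x))))
  ctrl-∪-assoc cA cB cC (dAB , dAC , dBC) (inC x) =
    trans (ctrl-∪-inʳ (ctrl-∪ cA cB) cC (∪-disjointˡ dAC dBC) x)
      (sym (trans (ctrl-∪-inʳ cA (ctrl-∪ cB cC) (∪-disjointʳ dAB dAC) (inʳ x)) (ctrl-∪-inʳ cB cC dBC x)))

  ports-disjoint : ∀ {k X m Y k' X' m' Y'} (F : Bigraph k X m Y) (G : Bigraph k' X' m' Y') →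
    Disjoint (Bigraph.V F) (Bigraph.V G) → Disjoint (Bigraph.P F) (Bigraph.P G)
  ports-disjoint F G d (v , i) p q = d v (Bigraph.P-node F v i p) (Bigraph.P-node G v i q)

  module _ {k l m n : ℕ} {X Y Z W : Names}
           (A : Bigraph k X l Y) (B : Bigraph l Y m Z) (C : Bigraph m Z n W)
           (dAB : SupportDisjoint A B) (dBC : SupportDisjoint B C) (dAC : SupportDisjoint A C) where
    private
      module A = Bigraph A
      module B = Bigraph B
      module C = Bigraph C

      dV : Disjoint₃ A.V B.V C.V
      dV = proj₁ dAB , proj₁ dAC , proj₁ dBC

      dE : Disjoint₃ A.E B.E C.E
      dE = proj₂ dAB , proj₂ dAC , proj₂ dBC

      dP : Disjoint₃ A.P B.P C.P
      dP = ports-disjoint A B (proj₁ dAB) , ports-disjoint A C (proj₁ dAC) , ports-disjoint B C (proj₁ dBC)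

    ctrl-assoc : ∀ v (p : T (((A.V ∪ B.V) ∪ C.V) v)) (q : T ((A.V ∪ (B.V ∪ C.V)) v)) κ →
      ctrl-∪ (ctrl-∪ A.ctrl B.ctrl) C.ctrl (v , p) κ ≡ ctrl-∪ A.ctrl (ctrl-∪ B.ctrl C.ctrl) (v , q) κ
    ctrl-assoc v p q = cong-app (ctrl-∪-assoc A.ctrl B.ctrl C.ctrl dV (parts₃ refl))

    prnt-assoc : ∀ a a' b b' →
      rawPlaceDom {k} {(A.V ∪ B.V) ∪ C.V} a ≡ rawPlaceDom {k} {A.V ∪ (B.V ∪ C.V)} a' →
      rawPlaceCod {n} {(A.V ∪ B.V) ∪ C.V} b ≡ rawPlaceCod {n} {A.V ∪ (B.V ∪ C.V)} b' →
      place-prnt (place-prnt A.prnt B.prnt) C.prnt a b ≡ place-prnt A.prnt (place-prnt B.prnt C.prnt) a' b'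
    prnt-assoc a a' b b' ra rb = begin
      place-prnt (place-prnt A.prnt B.prnt) C.prnt a b
        ≡⟨ place-prnt≗⨾ (place-prnt A.prnt B.prnt) C.prnt a b ⟩
      (place-prnt A.prnt B.prnt ⨾ C.prnt) a b
        ≡⟨ ⨾-cong (place-prnt≗⨾ A.prnt B.prnt) (≗₂-refl {R = C.prnt}) a b ⟩
      ((A.prnt ⨾ B.prnt) ⨾ C.prnt) a b
        ≡⟨ ⨾-assoc A.prnt B.prnt C.prnt dV dV (domParts (λ eq → eq) {a} {a'} ra) (codParts (λ eq → eq) {b} {b'} rb) ⟩
      (A.prnt ⨾ (B.prnt ⨾ C.prnt)) a' b'
        ≡⟨ ⨾-cong (≗₂-refl {R = A.prnt}) (place-prnt≗⨾ B.prnt C.prnt) a' b' ⟨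
      (A.prnt ⨾ place-prnt B.prnt C.prnt) a' b'
        ≡⟨ place-prnt≗⨾ A.prnt (place-prnt B.prnt C.prnt) a' b' ⟨
      place-prnt A.prnt (place-prnt B.prnt C.prnt) a' b'
        ∎

    link-assoc : ∀ a a' b b' →
      rawLinkDom {X} {(A.P ∪ B.P) ∪ C.P} a ≡ rawLinkDom {X} {A.P ∪ (B.P ∪ C.P)} a' →
      rawLinkCod {W} {(A.E ∪ B.E) ∪ C.E} b ≡ rawLinkCod {W} {A.E ∪ (B.E ∪ C.E)} b' →
      link-link {X} {Z} {W} (link-link {X} {Y} {Z} A.link B.link) C.link a b ≡
      link-link {X} {Y} {W} A.link (link-link {Y} {Z} {W} B.link C.link) a' b'
    link-assoc a a' b b' ra rb = begin
      link-link {X} {Z} {W} (link-link {X} {Y} {Z} A.link B.link) C.link a b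
        ≡⟨ link-link≗⨾ {X} {Z} {W} (link-link {X} {Y} {Z} A.link B.link) C.link a b ⟩
      (link-link {X} {Y} {Z} A.link B.link ⨾ C.link) a b
        ≡⟨ ⨾-cong (link-link≗⨾ {X} {Y} {Z} A.link B.link) (≗₂-refl {R = C.link}) a b ⟩
      ((A.link ⨾ B.link) ⨾ C.link) a b
        ≡⟨ ⨾-assoc A.link B.link C.link dP dE (domParts Elem-proj₁-injective {a} {a'} ra) (codParts Elem-proj₁-injective {b} {b'} rb) ⟩
      (A.link ⨾ (B.link ⨾ C.link)) a' b'
        ≡⟨ ⨾-cong (≗₂-refl {R = A.link}) (link-link≗⨾ {Y} {Z} {W} B.link C.link) a' b' ⟨
      (A.link ⨾ link-link {Y} {Z} {W} B.link C.link) a' b'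
        ≡⟨ link-link≗⨾ {X} {Y} {W} A.link (link-link {Y} {Z} {W} B.link C.link) a' b' ⟨
      link-link {X} {Y} {W} A.link (link-link {Y} {Z} {W} B.link C.link) a' b'
        ∎

mainTheorem1 : ∀ {c} (L : Frame c) (Sg : Signature) →
    let open FuzzyBigraphs L Sg in
    ∀ {k l m n : ℕ} {X Y Z W : Names}
      (A : Bigraph k X l Y) (B : Bigraph l Y m Z) (C : Bigraph m Z n W)
      (dAB : SupportDisjoint A B) (dBC : SupportDisjoint B C) (dAC : SupportDisjoint A C) →
      (C ∘ (B ∘ A [ dAB ]) [ ∘-disjointˡ {A = A} {B} {C} dAB dAC dBC ]) ≈ ((C ∘ B [ dBC ]) ∘ A [ ∘-disjointʳ {A = A} {B} {C} dBC dAB dAC ])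
mainTheorem1 L Sg A B C dAB dBC dAC = record
  { V-eq    = λ v → ∨-assoc (Bigraph.V A v) (Bigraph.V B v) (Bigraph.V C v)
  ; E-eq    = λ e → ∨-assoc (Bigraph.E A e) (Bigraph.E B e) (Bigraph.E C e)
  ; P-eq    = λ π → ∨-assoc (Bigraph.P A π) (Bigraph.P B π) (Bigraph.P C π)
  ; ctrl-eq = ctrl-assoc L Sg A B C dAB dBC dAC
  ; prnt-eq = prnt-assoc L Sg A B C dAB dBC dAC
  ; link-eq = link-assoc L Sg A B C dAB dBC dAC
  }
  where open FuzzyBigraphs L Sg
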